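{- Let $(\mathbf{A},\forall,\exists)$ be a monadic Gödel algebra, let $K(A)=\{(a,b)\in A\times A: a\wedge b=0\}$, and for $(a,b)\in K(A)$ define $\exists_K(a,b)=(\exists a,\forall b)$ and $\forall_K(a,b)=(\forall a,\exists b)$, and $\sim(a,b)=(b,a)$. Then for every $(a,b)\in K(A)$: (a) $\exists_K(a,b)\in K(A)$; (b) $\forall_K(a,b)=\sim\exists_K(\sim(a,b))$; (c) $\forall_K(a,b)\in K(A)$.
   Context: A Heyting algebra is an algebra $\langle A,\vee,\wedge,\Rightarrow,0,1\rangle$ whose reduct $\langle A,\vee,\wedge,0,1\rangle$ is a bounded lattice and which satisfies $x\wedge(x\Rightarrow y)=x\wedge y$, $x\wedge(y\Rightarrow z)=x\wedge((x\wedge y)\Rightarrow(x\wedge z))$, $(x\wedge y)\Rightarrow x=1$. A monadic Heyting algebra is a structure $(\mathbf{A},\forall,\exists)$ with $\mathbf{A}$ a Heyting algebra and unary operations satisfying $\forall x\leq x$, $x\leq\exists x$, $\forall(x\wedge y)=\forall x\wedge\forall y$, $\exists(x\vee y)=\exists x\vee\exists y$, $\forall 1=1$, $\exists 0=0$, $\forall\exists x=\exists x$, $\exists\forall x=\forall x$, and $\forall(x\Rightarrow y)\leq\exists x\Rightarrow\exists y$. A monadic Gödel algebra is a monadic Heyting algebra satisfying the prelinearity equation $(x\Rightarrow y)\vee(y\Rightarrow x)=1$ and the equation $\forall(\exists x\vee y)=\exists x\vee\forall y$. -}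

module Defs where

open import Level using (Level; suc)
open import Relation.Binary.PropositionalEquality using (_≡_)
open import Data.Product using (_×_; _,_; proj₁; proj₂)

record MonadicGodelAlgebra (a : Level) : Set (suc a) where
  infixr 6 _∨_
  infixr 7 _∧_
  infixr 5 _⇒_
  field
    Carrier : Set a
    _∨_ _∧_ _⇒_ : Carrier → Carrier → Carrier
    𝟘 𝟙 : Carrier
    ∀' ∃' : Carrier → Carrier
    ∨-assoc : ∀ x y z → (x ∨ y) ∨ z ≡ x ∨ (y ∨ z)
    ∨-comm  : ∀ x y → x ∨ y ≡ y ∨ x
    ∧-assoc : ∀ x y z → (x ∧ y) ∧ z ≡ x ∧ (y ∧ z)
    ∧-comm  : ∀ x y → x ∧ y ≡ y ∧ x
    ∨-absorbs-∧ : ∀ x y → x ∨ (x ∧ y) ≡ x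
    ∧-absorbs-∨ : ∀ x y → x ∧ (x ∨ y) ≡ x
    ∨-identity : ∀ x → x ∨ 𝟘 ≡ x
    ∧-identity : ∀ x → x ∧ 𝟙 ≡ x
    H1 : ∀ x y → x ∧ (x ⇒ y) ≡ x ∧ y
    H2 : ∀ x y z → x ∧ (y ⇒ z) ≡ x ∧ ((x ∧ y) ⇒ (x ∧ z))
    H3 : ∀ x y → (x ∧ y) ⇒ x ≡ 𝟙
    -- monadic axioms (x ≤ y means x ∧ y ≡ x)
    ∀-deflationary : ∀ x → ∀' x ∧ x ≡ ∀' x
    ∃-inflationary : ∀ x → x ∧ ∃' x ≡ x
    ∀-∧ : ∀ x y → ∀' (x ∧ y) ≡ ∀' x ∧ ∀' y
    ∃-∨ : ∀ x y → ∃' (x ∨ y) ≡ ∃' x ∨ ∃' y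
    ∀-𝟙 : ∀' 𝟙 ≡ 𝟙
    ∃-𝟘 : ∃' 𝟘 ≡ 𝟘
    ∀∃ : ∀ x → ∀' (∃' x) ≡ ∃' x
    ∃∀ : ∀ x → ∃' (∀' x) ≡ ∀' x
    ∀-⇒ : ∀ x y → ∀' (x ⇒ y) ∧ (∃' x ⇒ ∃' y) ≡ ∀' (x ⇒ y)
    prelinearity : ∀ x y → (x ⇒ y) ∨ (y ⇒ x) ≡ 𝟙
    ∀-∃-∨ : ∀ x y → ∀' (∃' x ∨ y) ≡ ∃' x ∨ ∀' y

module _ {a : Level} (M : MonadicGodelAlgebra a) where
  open MonadicGodelAlgebra M

  inK : Carrier × Carrier → Set a
  inK (x , y) = x ∧ y ≡ 𝟘

  ∃K : Carrier × Carrier → Carrier × Carrier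
  ∃K (x , y) = (∃' x , ∀' y)

  ∀K : Carrier × Carrier → Carrier × Carrier
  ∀K (x , y) = (∀' x , ∃' y)

  ∼ : Carrier × Carrier → Carrier × Carrier
  ∼ (x , y) = (y , x)

-- If a ∧ b = 0 then a ≤ ¬b, so ∀a ≤ ∀¬b ≤ ∃b ⇒ ∃0 = ¬∃b, i.e. ∀a ∧ ∃b = 0.
-- Applied to (a, b) and to (b, a) this gives (c) and (a); (b) holds by
-- definition.
module Submission where

open import Defs
open import Level using (Level)
open import Data.Product using (_×_; _,_)
open import Relation.Binary.PropositionalEquality
  using (_≡_; refl; sym; trans; cong; cong₂; module ≡-Reasoning)

module MonadicHeytingProperties {ℓ : Level} (M : MonadicGodelAlgebra ℓ) where
  open MonadicGodelAlgebra M
  open ≡-Reasoning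

  infix 4 _≤_
  infix 8 ¬_

  _≤_ : Carrier → Carrier → Set ℓ
  x ≤ y = x ∧ y ≡ x

  ¬_ : Carrier → Carrier
  ¬ x = x ⇒ 𝟘

  ∧-idem : ∀ x → x ∧ x ≡ x
  ∧-idem x = trans (cong (x ∧_) (sym (∨-absorbs-∧ x x))) (∧-absorbs-∨ x (x ∧ x))

  ∧-zeroˡ : ∀ x → 𝟘 ∧ x ≡ 𝟘
  ∧-zeroˡ x = trans (cong (𝟘 ∧_) (sym (trans (∨-comm 𝟘 x) (∨-identity x)))) (∧-absorbs-∨ 𝟘 x)

  ∧-zeroʳ : ∀ x → x ∧ 𝟘 ≡ 𝟘
  ∧-zeroʳ x = trans (∧-comm x 𝟘) (∧-zeroˡ x)

  ≤-trans : ∀ {x y z} → x ≤ y → y ≤ z → x ≤ z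
  ≤-trans {x} {y} {z} x≤y y≤z = begin
    x ∧ z        ≡⟨ cong (_∧ z) (sym x≤y) ⟩
    (x ∧ y) ∧ z  ≡⟨ ∧-assoc x y z ⟩
    x ∧ (y ∧ z)  ≡⟨ cong (x ∧_) y≤z ⟩
    x ∧ y        ≡⟨ x≤y ⟩
    x            ∎

  disjoint⇒≤¬ : ∀ x y → x ∧ y ≡ 𝟘 → x ≤ ¬ y
  disjoint⇒≤¬ x y x∧y≡𝟘 = begin
    x ∧ ¬ y                  ≡⟨ H2 x y 𝟘 ⟩
    x ∧ ((x ∧ y) ⇒ (x ∧ 𝟘))  ≡⟨ cong₂ (λ u v → x ∧ (u ⇒ v)) x∧y≡𝟘 (∧-zeroʳ x) ⟩
    x ∧ (𝟘 ⇒ 𝟘)              ≡⟨ cong (λ u → x ∧ (u ⇒ 𝟘)) (sym (∧-idem 𝟘)) ⟩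
    x ∧ ((𝟘 ∧ 𝟘) ⇒ 𝟘)        ≡⟨ cong (x ∧_) (H3 𝟘 𝟘) ⟩
    x ∧ 𝟙                    ≡⟨ ∧-identity x ⟩
    x                        ∎

  ≤¬⇒disjoint : ∀ x y → y ≤ ¬ x → x ∧ y ≡ 𝟘
  ≤¬⇒disjoint x y y≤¬x = begin
    x ∧ y              ≡⟨ cong (x ∧_) (sym y≤¬x) ⟩
    x ∧ (y ∧ ¬ x)      ≡⟨ cong (x ∧_) (∧-comm y (¬ x)) ⟩
    x ∧ (¬ x ∧ y)      ≡⟨ sym (∧-assoc x (¬ x) y) ⟩
    (x ∧ ¬ x) ∧ y      ≡⟨ cong (_∧ y) (trans (H1 x 𝟘) (∧-zeroʳ x)) ⟩
    𝟘 ∧ y              ≡⟨ ∧-zeroˡ y ⟩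
    𝟘                  ∎

  ∀-mono : ∀ {x y} → x ≤ y → ∀' x ≤ ∀' y
  ∀-mono {x} {y} x≤y = trans (sym (∀-∧ x y)) (cong ∀' x≤y)

  ∀¬≤¬∃ : ∀ x → ∀' (¬ x) ≤ ¬ ∃' x
  ∀¬≤¬∃ x = trans (cong (λ u → ∀' (¬ x) ∧ (∃' x ⇒ u)) (sym ∃-𝟘)) (∀-⇒ x 𝟘)

  ∀-∃-disjoint : ∀ x y → x ∧ y ≡ 𝟘 → ∀' x ∧ ∃' y ≡ 𝟘
  ∀-∃-disjoint x y x∧y≡𝟘 = trans (∧-comm (∀' x) (∃' y)) (≤¬⇒disjoint (∃' y) (∀' x) ∀x≤¬∃y)
    where
    ∀x≤¬∃y : ∀' x ≤ ¬ ∃' y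
    ∀x≤¬∃y = ≤-trans (∀-mono (disjoint⇒≤¬ x y x∧y≡𝟘)) (∀¬≤¬∃ y)

lemma4 : {ℓ : Level} (M : MonadicGodelAlgebra ℓ) (p : MonadicGodelAlgebra.Carrier M × MonadicGodelAlgebra.Carrier M) → inK M p → inK M (∃K M p) × (∀K M p ≡ ∼ M (∃K M (∼ M p))) × inK M (∀K M p)
lemma4 M (a , b) a∧b≡𝟘 = ∃K-inK , refl , ∀-∃-disjoint a b a∧b≡𝟘
  where
  open MonadicGodelAlgebra M
  open MonadicHeytingProperties M

  ∃K-inK : ∃' a ∧ ∀' b ≡ 𝟘
  ∃K-inK = trans (∧-comm (∃' a) (∀' b)) (∀-∃-disjoint b a (trans (∧-comm b a) a∧b≡𝟘))
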